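{- Let $\mathbf{ConQuant}$ be the category whose objects are unital quantales with a quantic conucleus $\langle Q,\cdot,\bigvee,I\rangle$ and whose morphisms are unital quantale homomorphisms $f$ with $f(I_1a)=I_2(f(a))$, and let $\mathbf{ConRQuant}$ be its subcategory of relational quantales with quantic conuclei. The assignment $\mathfrak F$ sending $\langle Q,\cdot,\bigvee,I\rangle$ to $\langle\hat{\mathcal Q},\bigvee,\circ,\hat I\rangle$, where $\hat{\mathcal Q}=\{\hat a\mid a\in Q\}$, $\hat a=\{\langle b,c\rangle\mid b\le a\cdot c\}$, ordered by inclusion, with relational composition $\circ$ and $\hat I(\hat a)=\widehat{Ia}$, and sending a morphism $f$ to $\hat f$ with $\hat f(\hat a)=\widehat{f(a)}$, is a functor $\mathfrak F:\mathbf{ConQuant}\to\mathbf{ConRQuant}$.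
   Context: A quantale is a complete join-semilattice with an associative multiplication distributing over arbitrary joins on both sides; unital if it has a unit $\varepsilon$. A unital quantale homomorphism preserves products, arbitrary joins and the unit. A quantic conucleus is a map $I$ with $Ia\le a$, $I(Ia)=Ia$, $a\le b\Rightarrow Ia\le Ib$, and $Ia\cdot Ib=I(Ia\cdot Ib)$. A relational quantale on a set $A$ is a family of binary relations on $A$ which, ordered by inclusion, is a complete lattice, is closed under relational composition, contains a neutral element for composition, and in which composition distributes over arbitrary joins on both sides. -}

module Defs where

open import Level using (Level; _⊔_) renaming (suc to lsuc)
open import Data.Product using (Σ; ∃; _×_; _,_; proj₁; proj₂)
open import Function using (id; _∘_)
open import Relation.Binary.Core using (Rel)
open import Relation.Binary.Structures using (IsPartialOrder)
open import Relation.Binary.PropositionalEquality using (_≡_)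

record ConQuantale (ℓ : Level) : Set (lsuc ℓ) where
  infixl 7 _·_
  infix 4 _≤_
  field
    Carrier        : Set ℓ
    _≤_            : Carrier → Carrier → Set ℓ
    isPartialOrder : IsPartialOrder _≡_ _≤_
    ⋁              : {J : Set ℓ} → (J → Carrier) → Carrier
    ⋁-upper        : {J : Set ℓ} (f : J → Carrier) (j : J) → f j ≤ ⋁ f
    ⋁-least        : {J : Set ℓ} (f : J → Carrier) (x : Carrier) →
                     ((j : J) → f j ≤ x) → ⋁ f ≤ x
    _·_            : Carrier → Carrier → Carrier
    ·-assoc        : (a b c : Carrier) → (a · b) · c ≡ a · (b · c)
    ·-distribˡ-⋁   : (a : Carrier) {J : Set ℓ} (f : J → Carrier) →
                     a · ⋁ f ≡ ⋁ (λ j → a · f j)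
    ·-distribʳ-⋁   : (a : Carrier) {J : Set ℓ} (f : J → Carrier) →
                     ⋁ f · a ≡ ⋁ (λ j → f j · a)
    ε              : Carrier
    ·-identityˡ    : (a : Carrier) → ε · a ≡ a
    ·-identityʳ    : (a : Carrier) → a · ε ≡ a
    I              : Carrier → Carrier
    I-deflationary : (a : Carrier) → I a ≤ a
    I-idempotent   : (a : Carrier) → I (I a) ≡ I a
    I-monotone     : (a b : Carrier) → a ≤ b → I a ≤ I b
    I-·            : (a b : Carrier) → I a · I b ≡ I (I a · I b)

open ConQuantale public

record ConQuantHom {ℓ : Level} (Q₁ Q₂ : ConQuantale ℓ) : Set (lsuc ℓ) where
  field
    fun   : Carrier Q₁ → Carrier Q₂
    fun-· : (a b : Carrier Q₁) → fun (_·_ Q₁ a b) ≡ _·_ Q₂ (fun a) (fun b)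
    fun-⋁ : {J : Set ℓ} (g : J → Carrier Q₁) → fun (⋁ Q₁ g) ≡ ⋁ Q₂ (λ j → fun (g j))
    fun-ε : fun (ε Q₁) ≡ ε Q₂
    fun-I : (a : Carrier Q₁) → fun (I Q₁ a) ≡ I Q₂ (fun a)

open ConQuantHom public

module _ {ℓ : Level} {A : Set ℓ} where

  infix 4 _⊆_ _≐_
  _⊆_ : Rel A ℓ → Rel A ℓ → Set ℓ
  R ⊆ S = (x y : A) → R x y → S x y

  _≐_ : Rel A ℓ → Rel A ℓ → Set ℓ
  R ≐ S = (R ⊆ S) × (S ⊆ R)

  infixl 7 _⨾_
  _⨾_ : Rel A ℓ → Rel A ℓ → Rel A ℓ
  (R ⨾ S) x z = ∃ λ y → R x y × S y z

-- Relational quantales with a quantic conucleus (objects of ConRQuant)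
-- A family of relations on A is a predicate Fam on Rel A ℓ
-- (required to be closed under extensional equality of relations).

module _ {ℓ : Level} {A : Set ℓ} (Fam : Rel A ℓ → Set ℓ) where

  Elt : Set (lsuc ℓ)
  Elt = Σ (Rel A ℓ) Fam

  IsLub : {J : Set ℓ} → (J → Rel A ℓ) → Rel A ℓ → Set (lsuc ℓ)
  IsLub f r = ((j : _) → f j ⊆ r) ×
              ((s : Rel A ℓ) → Fam s → ((j : _) → f j ⊆ s) → r ⊆ s)

  IsGlb : {J : Set ℓ} → (J → Rel A ℓ) → Rel A ℓ → Set (lsuc ℓ)
  IsGlb f r = ((j : _) → r ⊆ f j) ×
              ((s : Rel A ℓ) → Fam s → ((j : _) → s ⊆ f j) → s ⊆ r)

  IsNeutral : Rel A ℓ → Set (lsuc ℓ)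
  IsNeutral e = (r : Rel A ℓ) → Fam r → (e ⨾ r ≐ r) × (r ⨾ e ≐ r)

  record IsRelQuantale : Set (lsuc ℓ) where
    field
      Fam-resp   : (r s : Rel A ℓ) → r ≐ s → Fam r → Fam s
      joins      : {J : Set ℓ} (f : J → Rel A ℓ) → ((j : J) → Fam (f j)) →
                   Σ (Rel A ℓ) λ r → Fam r × IsLub f r
      meets      : {J : Set ℓ} (f : J → Rel A ℓ) → ((j : J) → Fam (f j)) →
                   Σ (Rel A ℓ) λ r → Fam r × IsGlb f r
      ⨾-closed   : (r s : Rel A ℓ) → Fam r → Fam s → Fam (r ⨾ s)
      neutral    : Σ (Rel A ℓ) λ e → Fam e × IsNeutral e
      ⨾-distribˡ : (r : Rel A ℓ) {J : Set ℓ} (f : J → Rel A ℓ) (s : Rel A ℓ) →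
                   Fam r → ((j : J) → Fam (f j)) → Fam s → IsLub f s →
                   IsLub (λ j → r ⨾ f j) (r ⨾ s)
      ⨾-distribʳ : (r : Rel A ℓ) {J : Set ℓ} (f : J → Rel A ℓ) (s : Rel A ℓ) →
                   Fam r → ((j : J) → Fam (f j)) → Fam s → IsLub f s →
                   IsLub (λ j → f j ⨾ r) (s ⨾ r)

  record IsRelConucleus (Î : Elt → Elt) : Set (lsuc ℓ) where
    field
      deflationary : (x : Elt) → proj₁ (Î x) ⊆ proj₁ x
      idempotent   : (x : Elt) → proj₁ (Î (Î x)) ≐ proj₁ (Î x)
      monotone     : (x y : Elt) → proj₁ x ⊆ proj₁ y → proj₁ (Î x) ⊆ proj₁ (Î y)
      -- Îx ∘ Îy = Î(Îx ∘ Îy), where z is (any representative of) Îx ∘ Îy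
      ⨾-stable     : (x y z : Elt) → proj₁ z ≐ proj₁ (Î x) ⨾ proj₁ (Î y) →
                     proj₁ (Î z) ≐ proj₁ z

  IsConRelQuantale : (Elt → Elt) → Set (lsuc ℓ)
  IsConRelQuantale Î = IsRelQuantale × IsRelConucleus Î

record IsConRelHom {ℓ : Level} {A₁ A₂ : Set ℓ}
                   (Fam₁ : Rel A₁ ℓ → Set ℓ) (Fam₂ : Rel A₂ ℓ → Set ℓ)
                   (Î₁ : Elt Fam₁ → Elt Fam₁) (Î₂ : Elt Fam₂ → Elt Fam₂)
                   (h : Elt Fam₁ → Elt Fam₂) : Set (lsuc ℓ) where
  field
    h-resp : (x y : Elt Fam₁) → proj₁ x ≐ proj₁ y → proj₁ (h x) ≐ proj₁ (h y)
    h-⨾    : (x y z : Elt Fam₁) → proj₁ z ≐ proj₁ x ⨾ proj₁ y →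
             proj₁ (h z) ≐ proj₁ (h x) ⨾ proj₁ (h y)
    h-⋁    : {J : Set ℓ} (f : J → Elt Fam₁) (s : Elt Fam₁) →
             IsLub Fam₁ (λ j → proj₁ (f j)) (proj₁ s) →
             IsLub Fam₂ (λ j → proj₁ (h (f j))) (proj₁ (h s))
    h-ε    : (e : Elt Fam₁) → IsNeutral Fam₁ (proj₁ e) → IsNeutral Fam₂ (proj₁ (h e))
    h-Î    : (x : Elt Fam₁) → proj₁ (h (Î₁ x)) ≐ proj₁ (Î₂ (h x))

module _ {ℓ : Level} (Q : ConQuantale ℓ) where

  hat : Carrier Q → Rel (Carrier Q) ℓ
  hat a b c = _≤_ Q b (_·_ Q a c)

  HatFam : Rel (Carrier Q) ℓ → Set ℓ
  HatFam r = Σ (Carrier Q) λ a → r ≐ hat a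

  ≐-refl : {r : Rel (Carrier Q) ℓ} → r ≐ r
  ≐-refl = (λ _ _ p → p) , (λ _ _ p → p)

  hatI : Elt HatFam → Elt HatFam
  hatI (_ , a , _) = hat (I Q a) , I Q a , ≐-refl

hatMap : {ℓ : Level} (Q₁ Q₂ : ConQuantale ℓ) → (Carrier Q₁ → Carrier Q₂) →
         Elt (HatFam Q₁) → Elt (HatFam Q₂)
hatMap Q₁ Q₂ f (_ , a , _) = hat Q₂ (f a) , f a , ≐-refl Q₂

-- The map a ↦ â is an order embedding of Q into the relations on Q
-- (â ⊆ b̂ forces a ≤ b by looking at ⟨a , ε⟩ ∈ â), and it turns products into
-- relational composites: â ⨾ b̂ = (a · b)^, with b · c as the middle point.
-- Hence 𝒬̂ is an isomorphic copy of Q, and every piece of structure is carried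
-- across. Joins, meets and the neutral element of 𝒬̂ are unique up to ≐, so
-- whatever witnesses the relational axioms hand us can be identified with the
-- images of the corresponding elements of Q; this is what makes f̂ a morphism.
module Submission where

open import Defs
  using ( ConQuantale; module ConQuantale; ConQuantHom; fun; fun-·; fun-⋁; fun-ε; fun-I
        ; _⊆_; _≐_; _⨾_; Elt; IsLub; IsGlb; IsNeutral
        ; IsRelQuantale; IsRelConucleus; IsConRelQuantale; IsConRelHom
        ; hat; HatFam; hatI; hatMap )
open import Level using (Level; Lift; lift)
open import Data.Bool using (Bool; true; false)
open import Data.Product using (Σ; _×_; _,_; proj₁; proj₂)
open import Function using (id; _∘_)
open import Relation.Binary.Core using (Rel)
open import Relation.Binary.Structures using (IsPartialOrder)
open import Relation.Binary.PropositionalEquality using (_≡_; refl; sym; trans; cong)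

module _ {ℓ : Level} {A : Set ℓ} where

  ⊆-trans : {r s t : Rel A ℓ} → r ⊆ s → s ⊆ t → r ⊆ t
  ⊆-trans r⊆s s⊆t x y = s⊆t x y ∘ r⊆s x y

  ≐-refl : {r : Rel A ℓ} → r ≐ r
  ≐-refl = (λ _ _ → id) , (λ _ _ → id)

  ≐-sym : {r s : Rel A ℓ} → r ≐ s → s ≐ r
  ≐-sym (r⊆s , s⊆r) = s⊆r , r⊆s

  ≐-trans : {r s t : Rel A ℓ} → r ≐ s → s ≐ t → r ≐ t
  ≐-trans (r⊆s , s⊆r) (s⊆t , t⊆s) = ⊆-trans r⊆s s⊆t , ⊆-trans t⊆s s⊆r

  ⨾-mono : {r r′ s s′ : Rel A ℓ} → r ⊆ r′ → s ⊆ s′ → r ⨾ s ⊆ r′ ⨾ s′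
  ⨾-mono r⊆r′ s⊆s′ x z (y , rxy , syz) = y , r⊆r′ x y rxy , s⊆s′ y z syz

  ⨾-cong : {r r′ s s′ : Rel A ℓ} → r ≐ r′ → s ≐ s′ → r ⨾ s ≐ r′ ⨾ s′
  ⨾-cong (r⊆r′ , r′⊆r) (s⊆s′ , s′⊆s) = ⨾-mono r⊆r′ s⊆s′ , ⨾-mono r′⊆r s′⊆s

  module _ (Fam : Rel A ℓ → Set ℓ) where

    isLub-resp-≐ : {J : Set ℓ} {f : J → Rel A ℓ} {s t : Rel A ℓ} →
                   s ≐ t → IsLub Fam f s → IsLub Fam f t
    isLub-resp-≐ (s⊆t , t⊆s) (upper , least) =
      (λ j → ⊆-trans (upper j) s⊆t) , (λ u Fu fj⊆u → ⊆-trans t⊆s (least u Fu fj⊆u))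

    isLub-unique : {J : Set ℓ} {f : J → Rel A ℓ} {s t : Rel A ℓ} → Fam s → Fam t →
                   IsLub Fam f s → IsLub Fam f t → s ≐ t
    isLub-unique Fs Ft (upperₛ , leastₛ) (upperₜ , leastₜ) =
      leastₛ _ Ft upperₜ , leastₜ _ Fs upperₛ

    isNeutral-resp-≐ : {e e′ : Rel A ℓ} → e ≐ e′ → IsNeutral Fam e → IsNeutral Fam e′
    isNeutral-resp-≐ e≐e′ neutral r Fr =
      ≐-trans (⨾-cong (≐-sym e≐e′) ≐-refl) (proj₁ (neutral r Fr)) ,
      ≐-trans (⨾-cong ≐-refl (≐-sym e≐e′)) (proj₂ (neutral r Fr))

    isNeutral-unique : {e e′ : Rel A ℓ} → Fam e → Fam e′ →
                       IsNeutral Fam e → IsNeutral Fam e′ → e ≐ e′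
    isNeutral-unique Fe Fe′ neutral neutral′ =
      ≐-trans (≐-sym (proj₂ (neutral′ _ Fe))) (proj₁ (neutral _ Fe′))

module QuantaleProperties {ℓ : Level} (Q : ConQuantale ℓ) where

  open ConQuantale Q
  private module ≤ = IsPartialOrder isPartialOrder

  private
    pair : Carrier → Carrier → Lift ℓ Bool → Carrier
    pair a b (lift true)  = a
    pair a b (lift false) = b

    ⋁-pair : {a b : Carrier} → a ≤ b → ⋁ (pair a b) ≡ b
    ⋁-pair {a} {b} a≤b = ≤.antisym (⋁-least (pair a b) b below-b) (⋁-upper (pair a b) (lift false))
      where
      below-b : (j : Lift ℓ Bool) → pair a b j ≤ b
      below-b (lift true)  = a≤b
      below-b (lift false) = ≤.refl

  ·-monoˡ-≤ : {a b : Carrier} (c : Carrier) → a ≤ b → a · c ≤ b · c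
  ·-monoˡ-≤ {a} {b} c a≤b = ≤.trans (⋁-upper (λ j → pair a b j · c) (lift true))
    (≤.reflexive (trans (sym (·-distribʳ-⋁ c (pair a b))) (cong (_· c) (⋁-pair a≤b))))

  ·-monoʳ-≤ : {a b : Carrier} (c : Carrier) → a ≤ b → c · a ≤ c · b
  ·-monoʳ-≤ {a} {b} c a≤b = ≤.trans (⋁-upper (λ j → c · pair a b j) (lift true))
    (≤.reflexive (trans (sym (·-distribˡ-⋁ c (pair a b))) (cong (c ·_) (⋁-pair a≤b))))

  hat-mono : {a b : Carrier} → a ≤ b → hat Q a ⊆ hat Q b
  hat-mono a≤b x y x≤ay = ≤.trans x≤ay (·-monoˡ-≤ y a≤b)

  hat-cancel-⊆ : {a b : Carrier} → hat Q a ⊆ hat Q b → a ≤ b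
  hat-cancel-⊆ {a} {b} â⊆b̂ =
    ≤.trans (â⊆b̂ a ε (≤.reflexive (sym (·-identityʳ a)))) (≤.reflexive (·-identityʳ b))

  hat-injective : {a b : Carrier} → hat Q a ≐ hat Q b → a ≡ b
  hat-injective (â⊆b̂ , b̂⊆â) = ≤.antisym (hat-cancel-⊆ â⊆b̂) (hat-cancel-⊆ b̂⊆â)

  hat-cong : {a b : Carrier} → a ≡ b → hat Q a ≐ hat Q b
  hat-cong refl = ≐-refl

  hat-· : (a b : Carrier) → hat Q a ⨾ hat Q b ≐ hat Q (a · b)
  hat-· a b =
    (λ x z (y , x≤ay , y≤bz) →
      ≤.trans x≤ay (≤.trans (·-monoʳ-≤ a y≤bz) (≤.reflexive (sym (·-assoc a b z))))) ,
    (λ x z x≤abz → b · z , ≤.trans x≤abz (≤.reflexive (·-assoc a b z)) , ≤.refl)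

  ⨾-hat : {r s : Rel Carrier ℓ} {a b : Carrier} →
          r ≐ hat Q a → s ≐ hat Q b → r ⨾ s ≐ hat Q (a · b)
  ⨾-hat {a = a} {b} r≐â s≐b̂ = ≐-trans (⨾-cong r≐â s≐b̂) (hat-· a b)

  hat-⋁-isLub : {J : Set ℓ} (f : J → Rel Carrier ℓ) (a : J → Carrier) →
                ((j : J) → f j ≐ hat Q (a j)) → IsLub (HatFam Q) f (hat Q (⋁ a))
  hat-⋁-isLub f a f≐â =
    (λ j → ⊆-trans (proj₁ (f≐â j)) (hat-mono (⋁-upper a j))) ,
    (λ s (c , s≐ĉ) f⊆s → ⊆-trans
      (hat-mono (⋁-least a c (λ j →
        hat-cancel-⊆ (⊆-trans (proj₂ (f≐â j)) (⊆-trans (f⊆s j) (proj₁ s≐ĉ))))))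
      (proj₂ s≐ĉ))

  isLub-hat⇒≡⋁ : {J : Set ℓ} (f : J → Rel Carrier ℓ) (a : J → Carrier) →
                 ((j : J) → f j ≐ hat Q (a j)) →
                 {s : Rel Carrier ℓ} {c : Carrier} → s ≐ hat Q c →
                 IsLub (HatFam Q) f s → c ≡ ⋁ a
  isLub-hat⇒≡⋁ f a f≐â {c = c} s≐ĉ lub = hat-injective (≐-trans (≐-sym s≐ĉ)
    (isLub-unique (HatFam Q) (c , s≐ĉ) (⋁ a , ≐-refl) lub (hat-⋁-isLub f a f≐â)))

  ⋀ : {J : Set ℓ} → (J → Carrier) → Carrier
  ⋀ {J} a = ⋁ {Σ Carrier λ x → (j : J) → x ≤ a j} proj₁

  hat-⋀-isGlb : {J : Set ℓ} (f : J → Rel Carrier ℓ) (a : J → Carrier) →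
                ((j : J) → f j ≐ hat Q (a j)) → IsGlb (HatFam Q) f (hat Q (⋀ a))
  hat-⋀-isGlb f a f≐â =
    (λ j → ⊆-trans (hat-mono (⋁-least proj₁ (a j) (λ (_ , x≤a) → x≤a j))) (proj₂ (f≐â j))) ,
    (λ s (c , s≐ĉ) s⊆f → ⊆-trans (proj₁ s≐ĉ) (hat-mono (⋁-upper proj₁
      (c , λ j → hat-cancel-⊆ (⊆-trans (proj₂ s≐ĉ) (⊆-trans (s⊆f j) (proj₁ (f≐â j))))))))

  hat-ε-isNeutral : IsNeutral (HatFam Q) (hat Q ε)
  hat-ε-isNeutral r (a , r≐â) =
    ≐-trans (⨾-hat ≐-refl r≐â) (≐-trans (hat-cong (·-identityˡ a)) (≐-sym r≐â)) ,
    ≐-trans (⨾-hat r≐â ≐-refl) (≐-trans (hat-cong (·-identityʳ a)) (≐-sym r≐â))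

  isNeutral-hat⇒≡ε : {e : Rel Carrier ℓ} {c : Carrier} → e ≐ hat Q c →
                     IsNeutral (HatFam Q) e → c ≡ ε
  isNeutral-hat⇒≡ε {c = c} e≐ĉ neutral = hat-injective (≐-trans (≐-sym e≐ĉ)
    (isNeutral-unique (HatFam Q) (c , e≐ĉ) (ε , ≐-refl) neutral hat-ε-isNeutral))

  ⨾-distribˡ-isLub : (r : Rel Carrier ℓ) {J : Set ℓ} (f : J → Rel Carrier ℓ) (s : Rel Carrier ℓ) →
                     HatFam Q r → ((j : J) → HatFam Q (f j)) → HatFam Q s →
                     IsLub (HatFam Q) f s → IsLub (HatFam Q) (λ j → r ⨾ f j) (r ⨾ s)
  ⨾-distribˡ-isLub r f s (a , r≐â) Ff (c , s≐ĉ) lub =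
    isLub-resp-≐ (HatFam Q) r⨾s-image (hat-⋁-isLub _ (λ j → a · b j) (λ j → ⨾-hat r≐â (b̂ j)))
    where
    b = λ j → proj₁ (Ff j)
    b̂ = λ j → proj₂ (Ff j)
    r⨾s-image : hat Q (⋁ λ j → a · b j) ≐ r ⨾ s
    r⨾s-image = ≐-sym (≐-trans (⨾-hat r≐â s≐ĉ) (hat-cong
      (trans (cong (a ·_) (isLub-hat⇒≡⋁ f b b̂ s≐ĉ lub)) (·-distribˡ-⋁ a b))))

  ⨾-distribʳ-isLub : (r : Rel Carrier ℓ) {J : Set ℓ} (f : J → Rel Carrier ℓ) (s : Rel Carrier ℓ) →
                     HatFam Q r → ((j : J) → HatFam Q (f j)) → HatFam Q s →
                     IsLub (HatFam Q) f s → IsLub (HatFam Q) (λ j → f j ⨾ r) (s ⨾ r)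
  ⨾-distribʳ-isLub r f s (a , r≐â) Ff (c , s≐ĉ) lub =
    isLub-resp-≐ (HatFam Q) s⨾r-image (hat-⋁-isLub _ (λ j → b j · a) (λ j → ⨾-hat (b̂ j) r≐â))
    where
    b = λ j → proj₁ (Ff j)
    b̂ = λ j → proj₂ (Ff j)
    s⨾r-image : hat Q (⋁ λ j → b j · a) ≐ s ⨾ r
    s⨾r-image = ≐-sym (≐-trans (⨾-hat s≐ĉ r≐â) (hat-cong
      (trans (cong (_· a) (isLub-hat⇒≡⋁ f b b̂ s≐ĉ lub)) (·-distribʳ-⋁ a b))))

  hatFam-isRelQuantale : IsRelQuantale (HatFam Q)
  hatFam-isRelQuantale = record
    { Fam-resp   = λ r s r≐s (a , r≐â) → a , ≐-trans (≐-sym r≐s) r≐â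
    ; joins      = λ f Ff → hat Q (⋁ (proj₁ ∘ Ff)) , (_ , ≐-refl) , hat-⋁-isLub f _ (proj₂ ∘ Ff)
    ; meets      = λ f Ff → hat Q (⋀ (proj₁ ∘ Ff)) , (_ , ≐-refl) , hat-⋀-isGlb f _ (proj₂ ∘ Ff)
    ; ⨾-closed   = λ r s (a , r≐â) (b , s≐b̂) → a · b , ⨾-hat r≐â s≐b̂
    ; neutral    = hat Q ε , (ε , ≐-refl) , hat-ε-isNeutral
    ; ⨾-distribˡ = ⨾-distribˡ-isLub
    ; ⨾-distribʳ = ⨾-distribʳ-isLub
    }

  rep : Elt (HatFam Q) → Carrier
  rep x = proj₁ (proj₂ x)

  rep-≐ : (x : Elt (HatFam Q)) → proj₁ x ≐ hat Q (rep x)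
  rep-≐ x = proj₂ (proj₂ x)

  rep-unique : (x : Elt (HatFam Q)) {c : Carrier} → proj₁ x ≐ hat Q c → rep x ≡ c
  rep-unique x x≐ĉ = hat-injective (≐-trans (≐-sym (rep-≐ x)) x≐ĉ)

  rep-mono : (x y : Elt (HatFam Q)) → proj₁ x ⊆ proj₁ y → rep x ≤ rep y
  rep-mono x y x⊆y = hat-cancel-⊆ (⊆-trans (proj₂ (rep-≐ x)) (⊆-trans x⊆y (proj₁ (rep-≐ y))))

  hatI-isRelConucleus : IsRelConucleus (HatFam Q) (hatI Q)
  hatI-isRelConucleus = record
    { deflationary = λ x → ⊆-trans (hat-mono (I-deflationary (rep x))) (proj₂ (rep-≐ x))
    ; idempotent   = λ x → hat-cong (I-idempotent (rep x))
    ; monotone     = λ x y x⊆y → hat-mono (I-monotone _ _ (rep-mono x y x⊆y))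
    ; ⨾-stable     = ⨾-stable
    }
    where
    ⨾-stable : (x y z : Elt (HatFam Q)) →
               proj₁ z ≐ proj₁ (hatI Q x) ⨾ proj₁ (hatI Q y) → proj₁ (hatI Q z) ≐ proj₁ z
    ⨾-stable x y z z≐IxIy = ≐-trans
      (hat-cong (trans (cong I z≡IaIb) (trans (sym (I-· (rep x) (rep y))) (sym z≡IaIb))))
      (≐-sym (rep-≐ z))
      where
      z≡IaIb : rep z ≡ I (rep x) · I (rep y)
      z≡IaIb = rep-unique z (≐-trans z≐IxIy (hat-· _ _))

  hatFam-isConRelQuantale : IsConRelQuantale (HatFam Q) (hatI Q)
  hatFam-isConRelQuantale = hatFam-isRelQuantale , hatI-isRelConucleus

module _ {ℓ : Level} (Q₁ Q₂ : ConQuantale ℓ) (f : ConQuantHom Q₁ Q₂) where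

  private
    module Q₁ = QuantaleProperties Q₁
    module Q₂ = QuantaleProperties Q₂
    open ConQuantale using (_·_; ⋁)

  hatMap-isConRelHom : IsConRelHom (HatFam Q₁) (HatFam Q₂) (hatI Q₁) (hatI Q₂) (hatMap Q₁ Q₂ (fun f))
  hatMap-isConRelHom = record
    { h-resp = λ x y x≐y → Q₂.hat-cong (cong (fun f) (Q₁.rep-unique x (≐-trans x≐y (Q₁.rep-≐ y))))
    ; h-⨾    = h-⨾
    ; h-⋁    = h-⋁
    ; h-ε    = λ e neutral → isNeutral-resp-≐ (HatFam Q₂)
                 (Q₂.hat-cong (sym (trans (cong (fun f) (Q₁.isNeutral-hat⇒≡ε (Q₁.rep-≐ e) neutral))
                                          (fun-ε f))))
                 Q₂.hat-ε-isNeutral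
    ; h-Î    = λ x → Q₂.hat-cong (fun-I f (Q₁.rep x))
    }
    where
    h-⨾ : (x y z : Elt (HatFam Q₁)) → proj₁ z ≐ proj₁ x ⨾ proj₁ y →
          hat Q₂ (fun f (Q₁.rep z)) ≐ hat Q₂ (fun f (Q₁.rep x)) ⨾ hat Q₂ (fun f (Q₁.rep y))
    h-⨾ x y z z≐x⨾y = ≐-trans
      (Q₂.hat-cong (trans (cong (fun f) z≡ab) (fun-· f (Q₁.rep x) (Q₁.rep y))))
      (≐-sym (Q₂.hat-· _ _))
      where
      z≡ab : Q₁.rep z ≡ _·_ Q₁ (Q₁.rep x) (Q₁.rep y)
      z≡ab = Q₁.rep-unique z (≐-trans z≐x⨾y (Q₁.⨾-hat (Q₁.rep-≐ x) (Q₁.rep-≐ y)))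

    h-⋁ : {J : Set ℓ} (g : J → Elt (HatFam Q₁)) (s : Elt (HatFam Q₁)) →
          IsLub (HatFam Q₁) (proj₁ ∘ g) (proj₁ s) →
          IsLub (HatFam Q₂) (λ j → hat Q₂ (fun f (Q₁.rep (g j)))) (hat Q₂ (fun f (Q₁.rep s)))
    h-⋁ g s lub = isLub-resp-≐ (HatFam Q₂)
      (Q₂.hat-cong (sym (trans (cong (fun f) s≡⋁) (fun-⋁ f (Q₁.rep ∘ g)))))
      (Q₂.hat-⋁-isLub _ (fun f ∘ Q₁.rep ∘ g) (λ _ → ≐-refl))
      where
      s≡⋁ : Q₁.rep s ≡ ⋁ Q₁ (Q₁.rep ∘ g)
      s≡⋁ = Q₁.isLub-hat⇒≡⋁ _ (Q₁.rep ∘ g) (Q₁.rep-≐ ∘ g) (Q₁.rep-≐ s) lub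

mainTheorem5 : {ℓ : Level} →
    -- 𝔉 sends objects of ConQuant to objects of ConRQuant
    ((Q : ConQuantale ℓ) → IsConRelQuantale (HatFam Q) (hatI Q)) ×
    -- 𝔉 sends morphisms of ConQuant to morphisms of ConRQuant
    ((Q₁ Q₂ : ConQuantale ℓ) (f : ConQuantHom Q₁ Q₂) →
      IsConRelHom (HatFam Q₁) (HatFam Q₂) (hatI Q₁) (hatI Q₂) (hatMap Q₁ Q₂ (fun f))) ×
    -- 𝔉 preserves identities
    ((Q : ConQuantale ℓ) (x : Elt (HatFam Q)) →
      proj₁ (hatMap Q Q id x) ≐ proj₁ x) ×
    -- 𝔉 preserves composition
    ((Q₁ Q₂ Q₃ : ConQuantale ℓ) (f : ConQuantHom Q₁ Q₂) (g : ConQuantHom Q₂ Q₃)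
      (x : Elt (HatFam Q₁)) →
      proj₁ (hatMap Q₁ Q₃ (fun g ∘ fun f) x) ≐
        proj₁ (hatMap Q₂ Q₃ (fun g) (hatMap Q₁ Q₂ (fun f) x)))
mainTheorem5 =
  QuantaleProperties.hatFam-isConRelQuantale ,
  hatMap-isConRelHom ,
  (λ Q x → ≐-sym (QuantaleProperties.rep-≐ Q x)) ,
  (λ _ _ _ _ _ _ → ≐-refl)
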